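{- For every integer $n\ge 3$, the $(2,2)$ broadcast domination number of the $3\times n$ grid graph satisfies \[\gamma_{2,2}(G_{3,n})=\left\lceil \frac{4n}{3}\right\rceil .\]
   Context: For positive integers $m,n$, $G_{m,n}$ denotes the $m\times n$ grid graph (the Cartesian product of a path on $m$ vertices and a path on $n$ vertices; $m$ rows and $n$ columns). For a graph $G=(V,E)$ with shortest-path distance $d$ and integers $1\le r\le t$, the reception strength of $u\in V$ with respect to a set $S\subseteq V$ is $r(u)=\sum_{v\in S,\ d(u,v)<t}\bigl(t-d(u,v)\bigr)$. A set $S\subseteq V$ is a $(t,r)$ broadcast dominating set if $r(u)\ge r$ for every $u\in V$. The $(t,r)$ broadcast domination number $\gamma_{t,r}(G)$ is the minimum cardinality of a $(t,r)$ broadcast dominating set of $G$. -}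

module Defs where

open import Data.Nat using (ℕ; zero; suc; _+_; _*_; _∸_; _≤_; _<_; _<?_; _/_)
open import Data.Fin using (Fin; toℕ)
open import Data.Product using (_×_; _,_; Σ; proj₁; proj₂)
open import Data.List using (List; map; length)
open import Data.Nat.ListAction using (sum)
open import Relation.Binary.PropositionalEquality using (_≡_)
open import Data.List.Relation.Unary.Unique.Propositional using (Unique)
open import Relation.Nullary using (yes; no)

Vertex : ℕ → ℕ → Set
Vertex m n = Fin m × Fin n

∣_-_∣ : ℕ → ℕ → ℕ
∣ a - b ∣ = (a ∸ b) + (b ∸ a)

-- Shortest-path distance in the grid graph P_m □ P_n, which is the
-- Manhattan (L1) distance between coordinates.
dist : ∀ {m n} → Vertex m n → Vertex m n → ℕ
dist (i , j) (i' , j') = ∣ toℕ i - toℕ i' ∣ + ∣ toℕ j - toℕ j' ∣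

contrib : ∀ {m n} → ℕ → Vertex m n → Vertex m n → ℕ
contrib t u v with dist u v <? t
... | yes _ = t ∸ dist u v
... | no  _ = 0

reception : ∀ {m n} → ℕ → List (Vertex m n) → Vertex m n → ℕ
reception t S u = sum (map (contrib t u) S)

-- S is a (t,r) broadcast dominating set of G_{m,n}
-- (a set is represented by a duplicate-free list; its cardinality is its length)
IsBroadcastDominating : ∀ {m n} → ℕ → ℕ → List (Vertex m n) → Set
IsBroadcastDominating t r S = Unique S × (∀ u → r ≤ reception t S u)

BroadcastDominationNumber : ℕ → ℕ → ℕ → ℕ → ℕ → Set
BroadcastDominationNumber m n t r k =
  Σ (List (Vertex m n)) (λ S → IsBroadcastDominating t r S × length S ≡ k)
  × (∀ (S : List (Vertex m n)) → IsBroadcastDominating t r S → k ≤ length S)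

⌈_/3⌉ : ℕ → ℕ
⌈ a /3⌉ = (a + 2) / 3

module Submission where

-- Since a tower at distance d contributes 2 ∸ d, a vertex is (2,2)-dominated iff it is a tower or
-- has at least two tower neighbours. Only adjacent columns interact, so a dominating set of the
-- 3 × n grid is read as a sequence of 3-bit columns, dominated window by window.
--
-- Lower bound: a potential `credit` on pairs of consecutive columns satisfies
-- credit b c + 4 ≤ credit a b + 3 |b| on each of the finitely many dominated windows a b c;
-- telescoping it along the grid gives 4n ≤ 3 |S|.
--
-- Upper bound: a column ●○●, and a column ○●○ next to a column ●○●, is dominated whatever its
-- other neighbours. Repeating ○●○ ●○● ○●○ and finishing with ●○● or ○●○ ●○● gives
-- 3 |S| ≤ 4n + 2, and ⌈4n/3⌉ is the only L with 4n ≤ 3L ≤ 4n + 2.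

open import Data.Bool using (Bool; true; false; if_then_else_; T)
open import Data.Empty using (⊥-elim)
open import Data.Fin using (Fin; zero; suc; toℕ; fromℕ<)
open import Data.Fin.Properties using (toℕ-injective; toℕ<n; toℕ-fromℕ<; all?)
open import Data.List using (List; []; _∷_; _++_; map; length; applyUpTo)
open import Data.List.Properties using (map-++; map-∘)
open import Data.List.Relation.Unary.All using (All; []; _∷_)
open import Data.List.Relation.Unary.AllPairs using ([]; _∷_)
open import Data.List.Relation.Unary.Unique.Propositional using (Unique)
open import Data.Nat using (ℕ; zero; suc; _+_; _*_; _∸_; _/_; _≤_; _<_; _≡ᵇ_; _<?_; _≤?_; z≤n; s≤s)
open import Data.Nat.DivMod using (m<n*o⇒m/o<n; m*n/n≡m; /-monoˡ-≤)
open import Data.Nat.ListAction using (sum)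
open import Data.Nat.ListAction.Properties using (sum-++)
open import Data.Nat.Properties
open import Algebra.Properties.CommutativeSemigroup +-commutativeSemigroup using (interchange; xy∙z≈xz∙y)
open import Data.Nat.Solver using (module +-*-Solver)
open import Data.Product using (Σ; _×_; _,_; proj₂)
open import Data.Sum using (_⊎_; inj₁; inj₂)
open import Function using (_∘_)
open import Relation.Binary.PropositionalEquality
open import Relation.Nullary using (Dec; yes; no)
open import Relation.Nullary.Decidable using (map′; _×-dec_; _→-dec_; from-yes)

open import Defs

χ : Bool → ℕ
χ true = 1
χ false = 0

χ≤1 : ∀ b → χ b ≤ 1
χ≤1 true = s≤s z≤n
χ≤1 false = z≤n

χ-≡ᵇ-refl : ∀ k → χ (k ≡ᵇ k) ≡ 1
χ-≡ᵇ-refl zero = refl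
χ-≡ᵇ-refl (suc k) = χ-≡ᵇ-refl k

χ-≡ᵇ-< : ∀ {k l} → k < l → χ (k ≡ᵇ l) ≡ 0
χ-≡ᵇ-< {zero} {suc l} _ = refl
χ-≡ᵇ-< {suc k} {suc l} (s≤s k<l) = χ-≡ᵇ-< k<l

χ-≡ᵇ1 : ∀ {k} → k ≤ 1 → χ (k ≡ᵇ 1) ≡ k
χ-≡ᵇ1 z≤n = refl
χ-≡ᵇ1 (s≤s z≤n) = refl

≡ᵇ≡true⇒≡ : ∀ {k l} → (k ≡ᵇ l) ≡ true → k ≡ l
≡ᵇ≡true⇒≡ {k} {l} p = ≡ᵇ⇒≡ k l (subst T (sym p) _)

sum-map-0 : ∀ {A : Set} {f : A → ℕ} xs → (∀ a → f a ≡ 0) → sum (map f xs) ≡ 0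
sum-map-0 [] _ = refl
sum-map-0 (a ∷ xs) f≗0 = cong₂ _+_ (f≗0 a) (sum-map-0 xs f≗0)

∑-cong : ∀ {f g : ℕ → ℕ} → (∀ y → f y ≡ g y) → ∀ n → sum (applyUpTo f n) ≡ sum (applyUpTo g n)
∑-cong f≗g zero = refl
∑-cong f≗g (suc n) = cong₂ _+_ (f≗g 0) (∑-cong (f≗g ∘ suc) n)

∑-+ : ∀ (f g : ℕ → ℕ) n → sum (applyUpTo (λ y → f y + g y) n) ≡ sum (applyUpTo f n) + sum (applyUpTo g n)
∑-+ f g zero = refl
∑-+ f g (suc n) =
  trans (cong (f 0 + g 0 +_) (∑-+ (f ∘ suc) (g ∘ suc) n)) (interchange (f 0) (g 0) _ _)

∑-0 : ∀ n → sum (applyUpTo (λ _ → 0) n) ≡ 0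
∑-0 zero = refl
∑-0 (suc n) = ∑-0 n

∑-χ-≡ᵇ : ∀ {n} (j : Fin n) → sum (applyUpTo (λ y → χ (toℕ j ≡ᵇ y)) n) ≡ 1
∑-χ-≡ᵇ {suc n} zero = cong suc (∑-0 n)
∑-χ-≡ᵇ {suc n} (suc j) = ∑-χ-≡ᵇ j

before : (ℕ → ℕ) → ℕ → ℕ
before f zero = 0
before f (suc x) = f x

before-cong : ∀ {f g : ℕ → ℕ} → (∀ z → f z ≡ g z) → ∀ z → before f z ≡ before g z
before-cong f≗g zero = refl
before-cong f≗g (suc z) = f≗g z

before-+ : ∀ f g z → before (λ z → f z + g z) z ≡ before f z + before g z
before-+ f g zero = refl
before-+ f g (suc z) = refl

before-0 : ∀ z → before (λ _ → 0) z ≡ 0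
before-0 zero = refl
before-0 (suc z) = refl

-- Reception for t = 2 at row x, column y when F x′ y′ towers stand at each (x′, y′). Positions are
-- natural numbers, so a neighbour with coordinate -1 is simply absent (`before` gives 0 there).
received : (ℕ → ℕ → ℕ) → ℕ → ℕ → ℕ
received F x y = 2 * F x y + F (suc x) y + before (λ x → F x y) x + F x (suc y) + before (F x) y

received-cong : ∀ {F G : ℕ → ℕ → ℕ} → (∀ x y → F x y ≡ G x y) → ∀ x y → received F x y ≡ received G x y
received-cong F≗G x y =
  cong₂ _+_ (cong₂ _+_ (cong₂ _+_ (cong₂ _+_ (cong (2 *_) (F≗G x y)) (F≗G (suc x) y))
                                  (before-cong (λ x → F≗G x y) x))
                       (F≗G x (suc y)))
            (before-cong (F≗G x) y)

received-+ : ∀ F G x y → received (λ x y → F x y + G x y) x y ≡ received F x y + received G x y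
received-+ F G x y = begin
  2 * (F x y + G x y) + (F (suc x) y + G (suc x) y) + before (λ x → F x y + G x y) x
    + (F x (suc y) + G x (suc y)) + before (λ y → F x y + G x y) y
    ≡⟨ cong₂ (λ p q → 2 * (F x y + G x y) + (F (suc x) y + G (suc x) y) + p + (F x (suc y) + G x (suc y)) + q)
             (before-+ (λ x → F x y) (λ x → G x y) x) (before-+ (F x) (G x) y) ⟩
  2 * (F x y + G x y) + (F (suc x) y + G (suc x) y) + (before (λ x → F x y) x + before (λ x → G x y) x)
    + (F x (suc y) + G x (suc y)) + (before (F x) y + before (G x) y)
    ≡⟨ regroup (F x y) (G x y) (F (suc x) y) (G (suc x) y) (before (λ x → F x y) x) (before (λ x → G x y) x)
               (F x (suc y)) (G x (suc y)) (before (F x) y) (before (G x) y) ⟩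
  received F x y + received G x y ∎
  where
  open ≡-Reasoning
  open +-*-Solver
  regroup : ∀ a a′ b b′ c c′ d d′ e e′ → 2 * (a + a′) + (b + b′) + (c + c′) + (d + d′) + (e + e′)
                                        ≡ (2 * a + b + c + d + e) + (2 * a′ + b′ + c′ + d′ + e′)
  regroup = solve 10 (λ a a′ b b′ c c′ d d′ e e′ →
    con 2 :* (a :+ a′) :+ (b :+ b′) :+ (c :+ c′) :+ (d :+ d′) :+ (e :+ e′)
      := (con 2 :* a :+ b :+ c :+ d :+ e) :+ (con 2 :* a′ :+ b′ :+ c′ :+ d′ :+ e′)) refl

received-0 : ∀ x y → received (λ _ _ → 0) x y ≡ 0
received-0 x y = cong₂ (λ p q → p + 0 + q) (before-0 x) (before-0 y)

pointAt : ℕ → ℕ → ℕ → ℕ → ℕ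
pointAt x′ y′ x y = χ (x′ ≡ᵇ x) * χ (y′ ≡ᵇ y)

2∸-indicators : ∀ d e → 2 ∸ (d + e) ≡ 2 * (χ (d ≡ᵇ 0) * χ (e ≡ᵇ 0)) + χ (d ≡ᵇ 1) * χ (e ≡ᵇ 0)
                                      + χ (d ≡ᵇ 0) * χ (e ≡ᵇ 1)
2∸-indicators 0 0 = refl
2∸-indicators 0 1 = refl
2∸-indicators 0 (suc (suc e)) = 0∸n≡0 e
2∸-indicators 1 0 = refl
2∸-indicators 1 (suc e) = 0∸n≡0 e
2∸-indicators (suc (suc d)) e = 0∸n≡0 (d + e)

∣-∣≡0 : ∀ x x′ → χ (∣ x - x′ ∣ ≡ᵇ 0) ≡ χ (x′ ≡ᵇ x)
∣-∣≡0 zero zero = refl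
∣-∣≡0 zero (suc x′) = refl
∣-∣≡0 (suc x) zero = refl
∣-∣≡0 (suc x) (suc x′) = ∣-∣≡0 x x′

∣-∣≡1 : ∀ x x′ → χ (∣ x - x′ ∣ ≡ᵇ 1) ≡ χ (x′ ≡ᵇ suc x) + χ (suc x′ ≡ᵇ x)
∣-∣≡1 zero zero = refl
∣-∣≡1 zero (suc zero) = refl
∣-∣≡1 zero (suc (suc x′)) = refl
∣-∣≡1 (suc zero) zero = refl
∣-∣≡1 (suc (suc x)) zero = refl
∣-∣≡1 (suc x) (suc x′) = ∣-∣≡1 x x′

2∸distance≡received-pointAt : ∀ x y x′ y′ → 2 ∸ (∣ x - x′ ∣ + ∣ y - y′ ∣) ≡ received (pointAt x′ y′) x y
2∸distance≡received-pointAt x y x′ y′ = begin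
  2 ∸ (dx + dy)
    ≡⟨ 2∸-indicators dx dy ⟩
  2 * (χ (dx ≡ᵇ 0) * χ (dy ≡ᵇ 0)) + χ (dx ≡ᵇ 1) * χ (dy ≡ᵇ 0) + χ (dx ≡ᵇ 0) * χ (dy ≡ᵇ 1)
    ≡⟨ cong₂ (λ p q → 2 * (p * q) + χ (dx ≡ᵇ 1) * q + p * χ (dy ≡ᵇ 1)) (∣-∣≡0 x x′) (∣-∣≡0 y y′) ⟩
  2 * (a * b) + χ (dx ≡ᵇ 1) * b + a * χ (dy ≡ᵇ 1)
    ≡⟨ cong₂ (λ p q → 2 * (a * b) + p * b + a * q) (∣-∣≡1 x x′) (∣-∣≡1 y y′) ⟩
  2 * (a * b) + (a⁺ + a⁻) * b + a * (b⁺ + b⁻)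
    ≡⟨ expand a b a⁺ a⁻ b⁺ b⁻ ⟩
  2 * (a * b) + a⁺ * b + a⁻ * b + a * b⁺ + a * b⁻
    ≡⟨ cong₂ (λ p q → 2 * (a * b) + a⁺ * b + p + a * b⁺ + q) (sym (before-row x)) (sym (before-column y)) ⟩
  received (pointAt x′ y′) x y ∎
  where
  open ≡-Reasoning
  open +-*-Solver
  dx = ∣ x - x′ ∣
  dy = ∣ y - y′ ∣
  a = χ (x′ ≡ᵇ x)
  b = χ (y′ ≡ᵇ y)
  a⁺ = χ (x′ ≡ᵇ suc x)
  b⁺ = χ (y′ ≡ᵇ suc y)
  a⁻ = χ (suc x′ ≡ᵇ x)
  b⁻ = χ (suc y′ ≡ᵇ y)
  before-row : ∀ x → before (λ x → χ (x′ ≡ᵇ x) * b) x ≡ χ (suc x′ ≡ᵇ x) * b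
  before-row zero = refl
  before-row (suc x) = refl
  before-column : ∀ y → before (λ y → a * χ (y′ ≡ᵇ y)) y ≡ a * χ (suc y′ ≡ᵇ y)
  before-column zero = sym (*-zeroʳ a)
  before-column (suc y) = refl
  expand : ∀ a b a⁺ a⁻ b⁺ b⁻ → 2 * (a * b) + (a⁺ + a⁻) * b + a * (b⁺ + b⁻)
                              ≡ 2 * (a * b) + a⁺ * b + a⁻ * b + a * b⁺ + a * b⁻
  expand = solve 6 (λ a b a⁺ a⁻ b⁺ b⁻ → con 2 :* (a :* b) :+ (a⁺ :+ a⁻) :* b :+ a :* (b⁺ :+ b⁻)
                                      := con 2 :* (a :* b) :+ a⁺ :* b :+ a⁻ :* b :+ a :* b⁺ :+ a :* b⁻) refl

module _ {m n : ℕ} where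

  contrib≡∸ : ∀ t (u v : Vertex m n) → contrib t u v ≡ t ∸ dist u v
  contrib≡∸ t u v with dist u v <? t
  ... | yes _ = refl
  ... | no d≮t = sym (m≤n⇒m∸n≡0 (≮⇒≥ d≮t))

  point : Vertex m n → ℕ → ℕ → ℕ
  point (i , j) = pointAt (toℕ i) (toℕ j)

  occ : List (Vertex m n) → ℕ → ℕ → ℕ
  occ S x y = sum (map (λ v → point v x y) S)

  occ-++ : ∀ S T x y → occ (S ++ T) x y ≡ occ S x y + occ T x y
  occ-++ S T x y = trans (cong sum (map-++ (λ v → point v x y) S T)) (sum-++ (map (λ v → point v x y) S) _)

  reception≡received-occ : ∀ S (i : Fin m) (j : Fin n) → reception 2 S (i , j) ≡ received (occ S) (toℕ i) (toℕ j)
  reception≡received-occ [] i j = sym (received-0 (toℕ i) (toℕ j))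
  reception≡received-occ (v@(i′ , j′) ∷ S) i j = begin
    contrib 2 (i , j) v + reception 2 S (i , j)
      ≡⟨ cong₂ _+_ (contrib≡∸ 2 (i , j) v) (reception≡received-occ S i j) ⟩
    2 ∸ dist (i , j) v + received (occ S) x y
      ≡⟨ cong (_+ received (occ S) x y) (2∸distance≡received-pointAt x y (toℕ i′) (toℕ j′)) ⟩
    received (point v) x y + received (occ S) x y
      ≡⟨ received-+ (point v) (occ S) x y ⟨
    received (occ (v ∷ S)) x y ∎
    where
    open ≡-Reasoning
    x = toℕ i
    y = toℕ j

  point∈01 : ∀ v x y → point v x y ≡ 0 ⊎ point v x y ≡ 1
  point∈01 (i , j) x y with toℕ i ≡ᵇ x | toℕ j ≡ᵇ y
  ... | false | _ = inj₁ refl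
  ... | true | false = inj₁ refl
  ... | true | true = inj₂ refl

  point-self : ∀ i j → point (i , j) (toℕ i) (toℕ j) ≡ 1
  point-self i j rewrite χ-≡ᵇ-refl (toℕ i) | χ-≡ᵇ-refl (toℕ j) = refl

  -- The two hypotheses are what make every other case of the `with` absurd.
  point-injective : ∀ {v w x y} → point v x y ≡ 1 → point w x y ≡ 1 → v ≡ w
  point-injective {i , j} {i′ , j′} {x} {y} _ _
    with toℕ i ≡ᵇ x in i≡x | toℕ j ≡ᵇ y in j≡y | toℕ i′ ≡ᵇ x in i′≡x | toℕ j′ ≡ᵇ y in j′≡y
  ... | true | true | true | true = cong₂ _,_
    (toℕ-injective (trans (≡ᵇ≡true⇒≡ i≡x) (sym (≡ᵇ≡true⇒≡ i′≡x))))
    (toℕ-injective (trans (≡ᵇ≡true⇒≡ j≡y) (sym (≡ᵇ≡true⇒≡ j′≡y))))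

  absent⇒occ≡0 : ∀ {v x y} S → All (v ≢_) S → point v x y ≡ 1 → occ S x y ≡ 0
  absent⇒occ≡0 [] [] _ = refl
  absent⇒occ≡0 {v} {x} {y} (w ∷ S) (v≢w ∷ v∉S) p with point∈01 w x y
  ... | inj₁ q = cong₂ _+_ q (absent⇒occ≡0 S v∉S p)
  ... | inj₂ q = ⊥-elim (v≢w (point-injective p q))

  occ≡0⇒absent : ∀ {i j} S → occ S (toℕ i) (toℕ j) ≡ 0 → All ((i , j) ≢_) S
  occ≡0⇒absent [] _ = []
  occ≡0⇒absent {i} {j} (w ∷ S) occ≡0 =
    (λ { refl → 0≢1+n (trans (sym (m+n≡0⇒m≡0 (point w (toℕ i) (toℕ j)) occ≡0)) (point-self i j)) })
    ∷ occ≡0⇒absent S (m+n≡0⇒n≡0 (point w (toℕ i) (toℕ j)) occ≡0)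

  Unique⇒occ≤1 : ∀ {S} → Unique S → ∀ x y → occ S x y ≤ 1
  Unique⇒occ≤1 [] x y = z≤n
  Unique⇒occ≤1 {v ∷ S} (v∉S ∷ unique) x y with point∈01 v x y
  ... | inj₁ p rewrite p = Unique⇒occ≤1 unique x y
  ... | inj₂ p rewrite p | absent⇒occ≡0 S v∉S p = ≤-refl

  occ≤1⇒Unique : ∀ S → (∀ x y → occ S x y ≤ 1) → Unique S
  occ≤1⇒Unique [] _ = []
  occ≤1⇒Unique ((i , j) ∷ S) occ≤1 =
    occ≡0⇒absent S (n≤0⇒n≡0 (+-cancelˡ-≤ 1 _ 0 at-self))
    ∷ occ≤1⇒Unique S (λ x y → ≤-trans (m≤n+m _ _) (occ≤1 x y))
    where
    at-self : 1 + occ S (toℕ i) (toℕ j) ≤ 1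
    at-self = subst (λ p → p + occ S (toℕ i) (toℕ j) ≤ 1) (point-self i j) (occ≤1 (toℕ i) (toℕ j))

pattern ● = true
pattern ○ = false

record Column : Set where
  constructor col
  field
    top middle bottom : Bool

open Column

empty centre ends : Column
empty = col ○ ○ ○
centre = col ○ ● ○
ends = col ● ○ ●

size : Column → ℕ
size (col a b c) = χ a + χ b + χ c

bit : Column → ℕ → ℕ
bit c 0 = χ (top c)
bit c 1 = χ (middle c)
bit c 2 = χ (bottom c)
bit c (suc (suc (suc _))) = 0

bit-empty : ∀ x → bit empty x ≡ 0
bit-empty 0 = refl
bit-empty 1 = refl
bit-empty 2 = refl
bit-empty (suc (suc (suc _))) = refl

bit≤1 : ∀ c x → bit c x ≤ 1
bit≤1 c 0 = χ≤1 (top c)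
bit≤1 c 1 = χ≤1 (middle c)
bit≤1 c 2 = χ≤1 (bottom c)
bit≤1 c (suc (suc (suc x))) = z≤n

_◂_ : Column → (ℕ → Column) → ℕ → Column
(c ◂ X) zero = c
(c ◂ X) (suc y) = X y

total : ℕ → (ℕ → Column) → ℕ
total n X = sum (applyUpTo (size ∘ X) n)

windowReception : Column → Column → Column → ℕ → ℕ
windowReception a b c x = 2 * bit b x + bit b (suc x) + before (bit b) x + bit c x + bit a x

Dominated : Column → Column → Column → Set
Dominated a b c = ∀ (r : Fin 3) → 2 ≤ windowReception a b c (toℕ r)

-- Z y is the column to the left of column y of the grid, so Z 0 is a border column.
Admissible : ℕ → (ℕ → Column) → Set
Admissible n Z = ∀ y → y < n → Dominated (Z y) (Z (suc y)) (Z (suc (suc y)))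

Dominated? : ∀ a b c → Dec (Dominated a b c)
Dominated? a b c = all? (λ r → 2 ≤? windowReception a b c (toℕ r))

∀-Bool? : {P : Bool → Set} → (∀ b → Dec (P b)) → Dec (∀ b → P b)
∀-Bool? P? = map′ (λ { (t , f) ● → t ; (t , f) ○ → f }) (λ h → h ● , h ○) (P? ● ×-dec P? ○)

∀-Column? : {P : Column → Set} → (∀ c → Dec (P c)) → Dec (∀ c → P c)
∀-Column? P? = map′ (λ h c → h (top c) (middle c) (bottom c)) (λ h a b c → h (col a b c))
                    (∀-Bool? λ a → ∀-Bool? λ b → ∀-Bool? λ c → P? (col a b c))

module _ {n : ℕ} where

  record HasColumns (S : List (Vertex 3 n)) (X : ℕ → Column) : Set where
    constructor hasColumns
    field
      occ≡bit : ∀ x y → occ S x y ≡ bit (X y) x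

  reception≡windowReception : ∀ {S X} → HasColumns S X → ∀ (r : Fin 3) (j : Fin n) →
    reception 2 S (r , j) ≡ windowReception ((empty ◂ X) (toℕ j)) (X (toℕ j)) (X (suc (toℕ j))) (toℕ r)
  reception≡windowReception {S} {X} S∼X r j = begin
    reception 2 S (r , j)                  ≡⟨ reception≡received-occ S r j ⟩
    received (occ S) x y                   ≡⟨ received-cong (HasColumns.occ≡bit S∼X) x y ⟩
    received (λ x y → bit (X y) x) x y
      ≡⟨ cong (2 * bit (X y) x + bit (X y) (suc x) + before (bit (X y)) x + bit (X (suc y)) x +_) (before-column y) ⟩
    windowReception ((empty ◂ X) y) (X y) (X (suc y)) x ∎
    where
    open ≡-Reasoning
    x = toℕ r
    y = toℕ j
    before-column : ∀ y → before (λ y → bit (X y) x) y ≡ bit ((empty ◂ X) y) x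
    before-column zero = sym (bit-empty x)
    before-column (suc y) = refl

  dominating⇒admissible : ∀ {S X} → HasColumns S X → (∀ u → 2 ≤ reception 2 S u) → Admissible n (empty ◂ X)
  dominating⇒admissible {S} {X} S∼X dominating y y<n r =
    subst (λ y → 2 ≤ windowReception ((empty ◂ X) y) (X y) (X (suc y)) (toℕ r)) (toℕ-fromℕ< y<n)
          (subst (2 ≤_) (reception≡windowReception S∼X r (fromℕ< y<n)) (dominating (r , fromℕ< y<n)))

  admissible⇒dominating : ∀ {S X} → HasColumns S X → Admissible n (empty ◂ X) → ∀ u → 2 ≤ reception 2 S u
  admissible⇒dominating S∼X admissible (r , j) =
    subst (2 ≤_) (sym (reception≡windowReception S∼X r j)) (admissible (toℕ j) (toℕ<n j) r)

  inColumn : List (Vertex 3 n) → ℕ → ℕ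
  inColumn S y = occ S 0 y + occ S 1 y + occ S 2 y

  point-rowsum : ∀ (v : Vertex 3 n) y → point v 0 y + point v 1 y + point v 2 y ≡ χ (toℕ (proj₂ v) ≡ᵇ y)
  point-rowsum (r , j) y = rows r (χ (toℕ j ≡ᵇ y))
    where
    open +-*-Solver
    rows : ∀ (r : Fin 3) c → χ (toℕ r ≡ᵇ 0) * c + χ (toℕ r ≡ᵇ 1) * c + χ (toℕ r ≡ᵇ 2) * c ≡ c
    rows zero = solve 1 (λ c → con 1 :* c :+ con 0 :* c :+ con 0 :* c := c) refl
    rows (suc zero) = solve 1 (λ c → con 0 :* c :+ con 1 :* c :+ con 0 :* c := c) refl
    rows (suc (suc zero)) = solve 1 (λ c → con 0 :* c :+ con 0 :* c :+ con 1 :* c := c) refl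

  length≡∑inColumn : ∀ (S : List (Vertex 3 n)) → length S ≡ sum (applyUpTo (inColumn S) n)
  length≡∑inColumn [] = sym (∑-0 n)
  length≡∑inColumn (v ∷ S) = sym (begin
    sum (applyUpTo (inColumn (v ∷ S)) n)
      ≡⟨ ∑-cong (λ y → regroup (point v 0 y) (point v 1 y) (point v 2 y) (occ S 0 y) (occ S 1 y) (occ S 2 y)) n ⟩
    sum (applyUpTo (λ y → (point v 0 y + point v 1 y + point v 2 y) + inColumn S y) n)
      ≡⟨ ∑-+ (λ y → point v 0 y + point v 1 y + point v 2 y) (inColumn S) n ⟩
    sum (applyUpTo (λ y → point v 0 y + point v 1 y + point v 2 y) n) + sum (applyUpTo (inColumn S) n)
      ≡⟨ cong₂ _+_ (trans (∑-cong (point-rowsum v) n) (∑-χ-≡ᵇ (proj₂ v))) (sym (length≡∑inColumn S)) ⟩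
    suc (length S) ∎)
    where
    open ≡-Reasoning
    open +-*-Solver
    regroup : ∀ p₀ p₁ p₂ o₀ o₁ o₂ → (p₀ + o₀) + (p₁ + o₁) + (p₂ + o₂) ≡ (p₀ + p₁ + p₂) + (o₀ + o₁ + o₂)
    regroup = solve 6 (λ p₀ p₁ p₂ o₀ o₁ o₂ → (p₀ :+ o₀) :+ (p₁ :+ o₁) :+ (p₂ :+ o₂)
                                          := (p₀ :+ p₁ :+ p₂) :+ (o₀ :+ o₁ :+ o₂)) refl

  length≡total : ∀ {S X} → HasColumns S X → length S ≡ total n X
  length≡total {S} S∼X =
    trans (length≡∑inColumn S) (∑-cong (λ y → cong₂ _+_ (cong₂ _+_ (occ≡bit 0 y) (occ≡bit 1 y)) (occ≡bit 2 y)) n)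
    where open HasColumns S∼X

-- credit a b is the least value of 1 + 3 · (towers before column b) − 4 · (columns before b) over the
-- dominated prefixes ending in the columns a b, as found by a shortest-path search. The pairs
-- (○○●, b) with b's top empty, and their mirror images, never follow a dominated window, so
-- their value only has to be large enough.
credit : Column → Column → ℕ
credit (col ○ ○ ○) _ = 1
credit (col ○ ● ○) (col ● _ ●) = 0
credit (col ○ ● ○) _ = 1
credit (col ○ ○ ●) (col ● ● _) = 1
credit (col ○ ○ ●) _ = 2
credit (col ● ○ ○) (col _ ● ●) = 1
credit (col ● ○ ○) _ = 2
credit (col ● ○ ●) _ = 2
credit (col ○ ● ●) _ = 3
credit (col ● ● ○) _ = 3
credit (col ● ● ●) _ = 5

credit-step : ∀ a b c → Dominated a b c → credit b c + 4 ≤ credit a b + 3 * size b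
credit-step = from-yes (∀-Column? λ a → ∀-Column? λ b → ∀-Column? λ c →
                          Dominated? a b c →-dec credit b c + 4 ≤? credit a b + 3 * size b)

credit-end : ∀ a → 1 ≤ credit a empty
credit-end = from-yes (∀-Column? λ a → 1 ≤? credit a empty)

admissible-lower-bound : ∀ n Z → Z (suc n) ≡ empty → Admissible n Z →
                         4 * n + 1 ≤ credit (Z 0) (Z 1) + 3 * total n (Z ∘ suc)
admissible-lower-bound zero Z Z₁≡empty _ rewrite Z₁≡empty = ≤-trans (credit-end (Z 0)) (m≤m+n _ _)
admissible-lower-bound (suc n) Z last≡empty admissible = begin
  4 * suc n + 1                                      ≡⟨ unfold ⟩
  (4 * n + 1) + 4                                    ≤⟨ +-monoˡ-≤ 4 previous ⟩
  credit (Z 1) (Z 2) + 3 * rest + 4                  ≡⟨ xy∙z≈xz∙y (credit (Z 1) (Z 2)) (3 * rest) 4 ⟩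
  (credit (Z 1) (Z 2) + 4) + 3 * rest                ≤⟨ +-monoˡ-≤ (3 * rest) step ⟩
  credit (Z 0) (Z 1) + 3 * size (Z 1) + 3 * rest     ≡⟨ +-assoc (credit (Z 0) (Z 1)) _ _ ⟩
  credit (Z 0) (Z 1) + (3 * size (Z 1) + 3 * rest)   ≡⟨ cong (credit (Z 0) (Z 1) +_) (*-distribˡ-+ 3 (size (Z 1)) rest) ⟨
  credit (Z 0) (Z 1) + 3 * total (suc n) (Z ∘ suc)   ∎
  where
  open ≤-Reasoning
  rest = total n (λ y → Z (2 + y))
  previous : 4 * n + 1 ≤ credit (Z 1) (Z 2) + 3 * rest
  previous = admissible-lower-bound n (Z ∘ suc) last≡empty (λ y y<n → admissible (suc y) (s≤s y<n))
  step : credit (Z 1) (Z 2) + 4 ≤ credit (Z 0) (Z 1) + 3 * size (Z 1)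
  step = credit-step (Z 0) (Z 1) (Z 2) (admissible 0 (s≤s z≤n))
  unfold : 4 * suc n + 1 ≡ (4 * n + 1) + 4
  unfold = solve 1 (λ n → con 4 :* (con 1 :+ n) :+ con 1 := (con 4 :* n :+ con 1) :+ con 4) refl n
    where open +-*-Solver

module _ {n : ℕ} where

  occ-below-last-row : ∀ S x y → occ S (3 + x) y ≡ 0
  occ-below-last-row S x y = sum-map-0 {f = λ (v : Vertex 3 n) → point v (3 + x) y} S λ
    { (zero , _) → refl ; (suc zero , _) → refl ; (suc (suc zero) , _) → refl }

  occ-beyond-last-column : ∀ S x → occ S x n ≡ 0
  occ-beyond-last-column S x = sum-map-0 {f = λ (v : Vertex 3 n) → point v x n} S λ (r , j) →
    trans (cong (χ (toℕ r ≡ᵇ x) *_) (χ-≡ᵇ-< (toℕ<n j))) (*-zeroʳ (χ (toℕ r ≡ᵇ x)))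

  columnsOf : List (Vertex 3 n) → ℕ → Column
  columnsOf S y = col (occ S 0 y ≡ᵇ 1) (occ S 1 y ≡ᵇ 1) (occ S 2 y ≡ᵇ 1)

  columnsOf-last : ∀ S → columnsOf S n ≡ empty
  columnsOf-last S = trans (cong₂ (λ p q → col (p ≡ᵇ 1) (q ≡ᵇ 1) (occ S 2 n ≡ᵇ 1)) (beyond 0) (beyond 1))
                           (cong (λ p → col ○ ○ (p ≡ᵇ 1)) (beyond 2))
    where beyond = occ-beyond-last-column S

  Unique⇒HasColumns : ∀ {S} → Unique S → HasColumns S (columnsOf S)
  Unique⇒HasColumns {S} unique = hasColumns occ≡bit
    where
    occ≡bit : ∀ x y → occ S x y ≡ bit (columnsOf S y) x
    occ≡bit 0 y = sym (χ-≡ᵇ1 (Unique⇒occ≤1 unique 0 y))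
    occ≡bit 1 y = sym (χ-≡ᵇ1 (Unique⇒occ≤1 unique 1 y))
    occ≡bit 2 y = sym (χ-≡ᵇ1 (Unique⇒occ≤1 unique 2 y))
    occ≡bit (suc (suc (suc x))) y = occ-below-last-row S x y

  lower-bound : ∀ {S} → IsBroadcastDominating 2 2 S → 4 * n ≤ 3 * length S
  lower-bound {S} (unique , dominating) = +-cancelʳ-≤ 1 (4 * n) (3 * length S) (begin
    4 * n + 1                       ≤⟨ admissible-lower-bound n (empty ◂ columnsOf S) (columnsOf-last S)
                                         (dominating⇒admissible S∼X dominating) ⟩
    1 + 3 * total n (columnsOf S)   ≡⟨ cong (λ l → 1 + 3 * l) (length≡total S∼X) ⟨
    1 + 3 * length S                ≡⟨ +-comm 1 _ ⟩
    3 * length S + 1                ∎)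
    where
    open ≤-Reasoning
    S∼X = Unique⇒HasColumns unique

module _ {n : ℕ} where

  shiftRight : Vertex 3 n → Vertex 3 (suc n)
  shiftRight (r , j) = r , suc j

  occ-shiftRight-0 : ∀ R x → occ (map shiftRight R) x 0 ≡ 0
  occ-shiftRight-0 R x = trans (cong sum (sym (map-∘ R))) (sum-map-0 R λ (r , _) → *-zeroʳ (χ (toℕ r ≡ᵇ x)))

  occ-shiftRight-suc : ∀ R x y → occ (map shiftRight R) x (suc y) ≡ occ R x y
  occ-shiftRight-suc R x y = cong sum (sym (map-∘ R))

  tower : Bool → Fin 3 → List (Vertex 3 (suc n))
  tower b r = if b then (r , zero) ∷ [] else []

  occ-tower : ∀ b r x y → occ (tower b r) x y ≡ χ b * point {n = suc n} (r , zero) x y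
  occ-tower ● r x y = refl
  occ-tower ○ r x y = refl

  firstColumn : Column → List (Vertex 3 (suc n))
  firstColumn c = tower (top c) zero ++ tower (middle c) (suc zero) ++ tower (bottom c) (suc (suc zero))

  occ-firstColumn : ∀ c x y → occ (firstColumn c) x y ≡ bit c x * χ (0 ≡ᵇ y)
  occ-firstColumn c x y =
    trans (occ-++ (tower a zero) _ x y)
          (trans (cong₂ _+_ (occ-tower a zero x y)
                            (trans (occ-++ (tower b (suc zero)) _ x y)
                                   (cong₂ _+_ (occ-tower b (suc zero) x y) (occ-tower d (suc (suc zero)) x y))))
                 (rows x))
    where
    open +-*-Solver
    a = top c
    b = middle c
    d = bottom c
    e = χ (0 ≡ᵇ y)
    rows : ∀ x → χ a * (χ (0 ≡ᵇ x) * e) + (χ b * (χ (1 ≡ᵇ x) * e) + χ d * (χ (2 ≡ᵇ x) * e)) ≡ bit c x * e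
    rows 0 = solve 4 (λ a b d e → a :* (con 1 :* e) :+ (b :* (con 0 :* e) :+ d :* (con 0 :* e)) := a :* e) refl
                     (χ a) (χ b) (χ d) e
    rows 1 = solve 4 (λ a b d e → a :* (con 0 :* e) :+ (b :* (con 1 :* e) :+ d :* (con 0 :* e)) := b :* e) refl
                     (χ a) (χ b) (χ d) e
    rows 2 = solve 4 (λ a b d e → a :* (con 0 :* e) :+ (b :* (con 0 :* e) :+ d :* (con 1 :* e)) := d :* e) refl
                     (χ a) (χ b) (χ d) e
    rows (suc (suc (suc x))) = solve 4 (λ a b d e → a :* (con 0 :* e) :+ (b :* (con 0 :* e) :+ d :* (con 0 :* e))
                                                  := con 0 :* e) refl
                                       (χ a) (χ b) (χ d) e

realise : ∀ n → (ℕ → Column) → List (Vertex 3 n)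
realise zero X = []
realise (suc n) X = firstColumn (X 0) ++ map shiftRight (realise n (X ∘ suc))

occ-realise : ∀ n X → (∀ y → n ≤ y → X y ≡ empty) → ∀ x y → occ (realise n X) x y ≡ bit (X y) x
occ-realise zero X support x y = sym (trans (cong (λ c → bit c x) (support y z≤n)) (bit-empty x))
occ-realise (suc n) X support x y =
  trans (occ-++ (firstColumn (X 0)) _ x y)
        (trans (cong (_+ occ (map shiftRight R) x y) (occ-firstColumn (X 0) x y)) (split y))
  where
  R = realise n (X ∘ suc)
  split : ∀ y → bit (X 0) x * χ (0 ≡ᵇ y) + occ (map shiftRight R) x y ≡ bit (X y) x
  split zero = trans (cong₂ _+_ (*-identityʳ (bit (X 0) x)) (occ-shiftRight-0 R x)) (+-identityʳ _)
  split (suc y) = trans (cong₂ _+_ (*-zeroʳ (bit (X 0) x)) (occ-shiftRight-suc R x y))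
                        (occ-realise n (X ∘ suc) (λ y n≤y → support (suc y) (s≤s n≤y)) x y)

optimalColumns : ℕ → ℕ → Column
optimalColumns 1 0 = ends
optimalColumns 2 0 = centre
optimalColumns 2 1 = ends
optimalColumns (suc (suc (suc n))) 0 = centre
optimalColumns (suc (suc (suc n))) 1 = ends
optimalColumns (suc (suc (suc n))) 2 = centre
optimalColumns (suc (suc (suc n))) (suc (suc (suc y))) = optimalColumns n y
optimalColumns _ _ = empty

optimalColumns-support : ∀ n y → n ≤ y → optimalColumns n y ≡ empty
optimalColumns-support 0 y _ = refl
optimalColumns-support 1 (suc y) _ = refl
optimalColumns-support 2 (suc zero) (s≤s ())
optimalColumns-support 2 (suc (suc y)) _ = refl
optimalColumns-support (suc (suc (suc n))) (suc (suc (suc y))) (s≤s (s≤s (s≤s n≤y))) =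
  optimalColumns-support n y n≤y

ends-dominated : ∀ a c → Dominated a ends c
ends-dominated = from-yes (∀-Column? λ a → ∀-Column? λ c → Dominated? a ends c)

centre-dominated-after-ends : ∀ c → Dominated ends centre c
centre-dominated-after-ends = from-yes (∀-Column? λ c → Dominated? ends centre c)

centre-dominated-before-ends : ∀ a → Dominated a centre ends
centre-dominated-before-ends = from-yes (∀-Column? λ a → Dominated? a centre ends)

optimalColumns-admissible : ∀ n a → Admissible n (a ◂ optimalColumns n)
optimalColumns-admissible 1 a 0 _ = ends-dominated a empty
optimalColumns-admissible 1 a (suc y) (s≤s ())
optimalColumns-admissible 2 a 0 _ = centre-dominated-before-ends a
optimalColumns-admissible 2 a 1 _ = ends-dominated centre empty
optimalColumns-admissible 2 a (suc (suc y)) (s≤s (s≤s ()))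
optimalColumns-admissible (suc (suc (suc n))) a 0 _ = centre-dominated-before-ends a
optimalColumns-admissible (suc (suc (suc n))) a 1 _ = ends-dominated centre centre
optimalColumns-admissible (suc (suc (suc n))) a 2 _ = centre-dominated-after-ends (optimalColumns n 0)
optimalColumns-admissible (suc (suc (suc n))) a 3 (s≤s (s≤s (s≤s y<n))) =
  optimalColumns-admissible n centre 0 y<n
optimalColumns-admissible (suc (suc (suc n))) a (suc (suc (suc (suc y)))) (s≤s (s≤s (s≤s y<n))) =
  optimalColumns-admissible n centre (suc y) y<n

optimalColumns-total : ∀ n → 3 * total n (optimalColumns n) ≤ 4 * n + 2
optimalColumns-total 0 = z≤n
optimalColumns-total 1 = ≤-refl
optimalColumns-total 2 = n≤1+n 9
optimalColumns-total (suc (suc (suc n))) = begin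
  3 * (4 + total n (optimalColumns n))  ≡⟨ *-distribˡ-+ 3 4 _ ⟩
  12 + 3 * total n (optimalColumns n)   ≤⟨ +-monoʳ-≤ 12 (optimalColumns-total n) ⟩
  12 + (4 * n + 2)               ≡⟨ solve 1 (λ n → con 12 :+ (con 4 :* n :+ con 2)
                                                 := con 4 :* (con 3 :+ n) :+ con 2) refl n ⟩
  4 * (3 + n) + 2                ∎
  where
  open ≤-Reasoning
  open +-*-Solver

upper-bound : ∀ n → Σ (List (Vertex 3 n)) λ S → IsBroadcastDominating 2 2 S × 3 * length S ≤ 4 * n + 2
upper-bound n = S , (unique , admissible⇒dominating S∼X (optimalColumns-admissible n empty)) ,
                subst (λ l → 3 * l ≤ 4 * n + 2) (sym (length≡total S∼X)) (optimalColumns-total n)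
  where
  S = realise n (optimalColumns n)
  S∼X : HasColumns S (optimalColumns n)
  S∼X = hasColumns (occ-realise n (optimalColumns n) (optimalColumns-support n))
  unique : Unique S
  unique = occ≤1⇒Unique S λ x y → subst (_≤ 1) (sym (HasColumns.occ≡bit S∼X x y)) (bit≤1 (optimalColumns n y) x)

⌈/3⌉-≤ : ∀ {a l} → a ≤ 3 * l → ⌈ a /3⌉ ≤ l
⌈/3⌉-≤ {a} {l} a≤3l = ≤-pred (m<n*o⇒m/o<n (begin-strict
  a + 2       <⟨ +-monoʳ-< a (n<1+n 2) ⟩
  a + 3       ≤⟨ +-monoˡ-≤ 3 a≤3l ⟩
  3 * l + 3   ≡⟨ +-comm (3 * l) 3 ⟩
  3 + 3 * l   ≡⟨ cong (3 +_) (*-comm 3 l) ⟩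
  suc l * 3   ∎))
  where open ≤-Reasoning

≤-⌈/3⌉ : ∀ {a l} → 3 * l ≤ a + 2 → l ≤ ⌈ a /3⌉
≤-⌈/3⌉ {a} {l} 3l≤a+2 = begin
  l              ≡⟨ m*n/n≡m l 3 ⟨
  l * 3 / 3      ≤⟨ /-monoˡ-≤ 3 (subst (_≤ a + 2) (*-comm 3 l) 3l≤a+2) ⟩
  (a + 2) / 3    ∎
  where open ≤-Reasoning

mainTheorem1 : (n : ℕ) → 3 ≤ n → BroadcastDominationNumber 3 n 2 2 ⌈ 4 * n /3⌉
mainTheorem1 n _ =
  let S , dominating , 3∣S∣≤4n+2 = upper-bound n in
  (S , dominating , ≤-antisym (≤-⌈/3⌉ 3∣S∣≤4n+2) (⌈/3⌉-≤ (lower-bound dominating))) ,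
  λ _ dominating′ → ⌈/3⌉-≤ (lower-bound dominating′)
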